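{- Let $G$ be a 2-tree. Suppose that $G$ has a branch $B=B(\{v_1,v_2\},u_0)$ which is an ear, a hat, or a double hat of $G$ (with the labelling of vertices as in the definitions of these branches). Let $G'=G-(V(B)\setminus\{v_1,v_2\})$. If $G'$ admits an odd 4-coloring $\varphi'$, then $\varphi'$ can be extended to a proper 4-coloring of $G$ such that every vertex of $V(G)$ other than $v_1$ satisfies the odd condition.
   Context: A graph $G$ is a 2-tree if it can be built from $K_3$ by repeatedly adding a new vertex adjacent to exactly the two ends of an existing edge. A proper 4-coloring is a map $\varphi:V(G)\to\{1,2,3,4\}$ with adjacent vertices receiving different colors; a vertex $v$ satisfies the odd condition with respect to $\varphi$ if $|\varphi^{ -1}(i)\cap N_G(v)|$ is odd for some color $i$; an odd 4-coloring is a proper 4-coloring in which every non-isolated vertex satisfies the odd condition. For an edge $\{v_1,v_2\}$ and a common neighbor $u$, the branch $B(\{v_1,v_2\},u)$ is the subgraph induced by $\{v_1,v_2\}\cup V(G_u)$ where $G_u$ is the component of $G-\{v_1,v_2\}$ containing $u$. An ear is a branch $B(\{v_1,v_2\},u_0)$ with vertex set $\{v_1,v_2,u_0\}$ and $N_G(u_0)=\{v_1,v_2\}$. A hat is a branch $B(\{v_1,v_2\},u_0)$ with vertex set $\{v_1,v_2,u_0,u_1,u_2\}$ such that $N_G(u_0)=\{v_1,v_2,u_1,u_2\}$, $N_G(u_1)=\{v_1,u_0\}$, $N_G(u_2)=\{v_2,u_0\}$. A double hat is a branch $B(\{v_1,v_2\},u_0)$ with vertex set $\{v_1,v_2,u_0,\dots,u_6\}$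 such that $N_G(u_0)=\{v_1,v_2,u_1,u_2,u_4,u_5\}$, $N_G(u_1)=\{v_1,u_0,u_3,u_4\}$, $N_G(u_2)=\{v_2,u_0,u_5,u_6\}$, $N_G(u_3)=\{v_1,u_1\}$, $N_G(u_4)=\{u_0,u_1\}$, $N_G(u_5)=\{u_0,u_2\}$, $N_G(u_6)=\{v_2,u_2\}$. -}

module Defs where

open import Data.Nat using (ℕ; zero; suc; _<_; _≥_; _%_)
open import Data.Fin using (Fin; toℕ; _≟_)
open import Data.Bool using (Bool; true; false; _∧_; not)
open import Data.List using (List; []; _∷_; length; filterᵇ; allFin)
open import Data.Bool.ListAction using (any)
open import Data.List.Membership.Propositional using (_∈_)
open import Data.Product using (Σ; ∃; ∃-syntax; _×_; _,_)
open import Data.Sum using (_⊎_)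
open import Function.Bundles using (_⇔_)
open import Function.Definitions using (Injective)
open import Relation.Nullary using (¬_; does)
open import Relation.Binary.PropositionalEquality using (_≡_; _≢_)

record Graph (n : ℕ) : Set where
  field
    adj    : Fin n → Fin n → Bool
    sym    : ∀ x y → adj x y ≡ adj y x
    irrefl : ∀ x → adj x x ≡ false

open Graph public

Adj : ∀ {n} → Graph n → Fin n → Fin n → Set
Adj G x y = adj G x y ≡ true

NbhdIs : ∀ {n} → Graph n → Fin n → List (Fin n) → Set
NbhdIs G x L = ∀ y → Adj G x y ⇔ (y ∈ L)

-- 2-trees: G is obtained from K₃ by repeatedly adding a vertex adjacent
-- to exactly the two ends of an existing edge.  Encoded by an ordering
-- σ of the vertices (σ 0, σ 1, σ 2 the initial triangle; σ k for k ≥ 3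
-- the k-th added vertex, whose neighbours among earlier vertices are
-- exactly the two ends σ a, σ b of an edge).

IsTwoTree : ∀ {n} → Graph n → Set
IsTwoTree {n} G =
  3 Data.Nat.≤ n ×
  Σ (Fin n → Fin n) λ σ →
    Injective _≡_ _≡_ σ ×
    (∀ i j → toℕ i < 3 → toℕ j < 3 → i ≢ j → Adj G (σ i) (σ j)) ×
    (∀ k → toℕ k ≥ 3 →
       Σ (Fin n) λ a → Σ (Fin n) λ b →
         toℕ a < toℕ k × toℕ b < toℕ k × Adj G (σ a) (σ b) ×
         (∀ j → toℕ j < toℕ k → Adj G (σ k) (σ j) ⇔ (j ≡ a ⊎ j ≡ b)))

data Conn {n} (G : Graph n) (v₁ v₂ : Fin n) : Fin n → Fin n → Set where
  conn-refl : ∀ {x} → x ≢ v₁ → x ≢ v₂ → Conn G v₁ v₂ x x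
  conn-step : ∀ {x y z} → x ≢ v₁ → x ≢ v₂ → Adj G x y →
              Conn G v₁ v₂ y z → Conn G v₁ v₂ x z

InBranch : ∀ {n} → Graph n → Fin n → Fin n → Fin n → Fin n → Set
InBranch G v₁ v₂ u x = x ≡ v₁ ⊎ x ≡ v₂ ⊎ Conn G v₁ v₂ u x

BranchWithVertices : ∀ {n} → Graph n → Fin n → Fin n → Fin n →
                     List (Fin n) → Set
BranchWithVertices G v₁ v₂ u L =
  Adj G v₁ v₂ × Adj G u v₁ × Adj G u v₂ ×
  (∀ x → InBranch G v₁ v₂ u x ⇔ (x ∈ L))

IsEar : ∀ {n} → Graph n → (v₁ v₂ u₀ : Fin n) → Set
IsEar G v₁ v₂ u₀ =
  BranchWithVertices G v₁ v₂ u₀ (v₁ ∷ v₂ ∷ u₀ ∷ []) ×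
  NbhdIs G u₀ (v₁ ∷ v₂ ∷ [])

IsHat : ∀ {n} → Graph n → (v₁ v₂ u₀ u₁ u₂ : Fin n) → Set
IsHat G v₁ v₂ u₀ u₁ u₂ =
  BranchWithVertices G v₁ v₂ u₀ (v₁ ∷ v₂ ∷ u₀ ∷ u₁ ∷ u₂ ∷ []) ×
  NbhdIs G u₀ (v₁ ∷ v₂ ∷ u₁ ∷ u₂ ∷ []) ×
  NbhdIs G u₁ (v₁ ∷ u₀ ∷ []) ×
  NbhdIs G u₂ (v₂ ∷ u₀ ∷ [])

IsDoubleHat : ∀ {n} → Graph n → (v₁ v₂ u₀ u₁ u₂ u₃ u₄ u₅ u₆ : Fin n) → Set
IsDoubleHat G v₁ v₂ u₀ u₁ u₂ u₃ u₄ u₅ u₆ =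
  BranchWithVertices G v₁ v₂ u₀
    (v₁ ∷ v₂ ∷ u₀ ∷ u₁ ∷ u₂ ∷ u₃ ∷ u₄ ∷ u₅ ∷ u₆ ∷ []) ×
  NbhdIs G u₀ (v₁ ∷ v₂ ∷ u₁ ∷ u₂ ∷ u₄ ∷ u₅ ∷ []) ×
  NbhdIs G u₁ (v₁ ∷ u₀ ∷ u₃ ∷ u₄ ∷ []) ×
  NbhdIs G u₂ (v₂ ∷ u₀ ∷ u₅ ∷ u₆ ∷ []) ×
  NbhdIs G u₃ (v₁ ∷ u₁ ∷ []) ×
  NbhdIs G u₄ (u₀ ∷ u₁ ∷ []) ×
  NbhdIs G u₅ (u₀ ∷ u₂ ∷ []) ×
  NbhdIs G u₆ (v₂ ∷ u₂ ∷ [])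

data SpecialBranch {n} (G : Graph n) (v₁ v₂ u₀ : Fin n) :
                   List (Fin n) → Set where
  ear       : IsEar G v₁ v₂ u₀ → SpecialBranch G v₁ v₂ u₀ (u₀ ∷ [])
  hat       : ∀ u₁ u₂ → IsHat G v₁ v₂ u₀ u₁ u₂ →
              SpecialBranch G v₁ v₂ u₀ (u₀ ∷ u₁ ∷ u₂ ∷ [])
  doubleHat : ∀ u₁ u₂ u₃ u₄ u₅ u₆ →
              IsDoubleHat G v₁ v₂ u₀ u₁ u₂ u₃ u₄ u₅ u₆ →
              SpecialBranch G v₁ v₂ u₀
                (u₀ ∷ u₁ ∷ u₂ ∷ u₃ ∷ u₄ ∷ u₅ ∷ u₆ ∷ [])

-- Colourings of induced subgraphs G[S], S : Fin n → Bool.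
-- Colours {1,2,3,4} are represented by Fin 4.

Coloring : ℕ → Set
Coloring n = Fin n → Fin 4

colorNbrCount : ∀ {n} → Graph n → (Fin n → Bool) → Coloring n →
                Fin n → Fin 4 → ℕ
colorNbrCount {n} G S φ v i =
  length (filterᵇ (λ x → S x ∧ adj G v x ∧ does (φ x ≟ i)) (allFin n))

OddCondition : ∀ {n} → Graph n → (Fin n → Bool) → Coloring n → Fin n → Set
OddCondition G S φ v = ∃[ i ] (colorNbrCount G S φ v i % 2 ≡ 1)

ProperOn : ∀ {n} → Graph n → (Fin n → Bool) → Coloring n → Set
ProperOn G S φ = ∀ x y → S x ≡ true → S y ≡ true → Adj G x y → φ x ≢ φ y

NonIsolatedIn : ∀ {n} → Graph n → (Fin n → Bool) → Fin n → Set
NonIsolatedIn G S v = ∃[ x ] (S x ≡ true × Adj G v x)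

OddColoringOn : ∀ {n} → Graph n → (Fin n → Bool) → Coloring n → Set
OddColoringOn G S φ =
  ProperOn G S φ ×
  (∀ v → S v ≡ true → NonIsolatedIn G S v → OddCondition G S φ v)

allV : ∀ {n} → Fin n → Bool
allV _ = true

notIn : ∀ {n} → List (Fin n) → Fin n → Bool
notIn R x = not (any (λ y → does (x ≟ y)) R)

{-# OPTIONS --safe #-}
-- The inner vertices of the branch are coloured greedily, each avoiding three
-- colours, which four colours always allow.  The three colours are chosen so
-- that every inner vertex sees some colour exactly once among its neighbours, and
-- so that no inner neighbour of v₂ receives a colour i that appears an odd number
-- of times around v₂ in G′; then v₂ still sees i an odd number of times.  Every
-- other vertex of G′ has no inner neighbour, so its coloured neighbourhood is the
-- same as in G′, and it is not isolated there since a 2-tree has no isolated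
-- vertex; so it inherits the odd condition from φ′.
--
-- The labels of a hat or double hat need not be distinct.  When u₁ = v₂ the
-- branch collapses onto the triangle v₁ v₂ u₀, which is then a whole component
-- of G and is simply coloured with three colours.
module Submission where

open import Defs hiding (sym)
open import Data.Nat using (ℕ; zero; suc; _%_; _<_; z≤n; s≤s; _<?_)
open import Data.Nat.Properties using (≮⇒≥; 1+n≰n)
open import Data.Fin using (Fin; zero; suc; toℕ; _≟_; punchOut)
open import Data.Fin.Properties using (any?; all?; punchOut-injective; injective⇒≤; suc-injective)
open import Data.Bool using (Bool; true; false; T; T?; _∧_; if_then_else_)
open import Data.List using (List; []; _∷_; length; filterᵇ; allFin; tabulate; map)
open import Data.List.Properties using (filter-none; filter-accept; filter-reject; filter-≐)
open import Data.List.Membership.Propositional using (_∈_; _∉_)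
open import Data.List.Membership.Propositional.Properties using (∈-map⁺)
open import Data.List.Relation.Unary.Any using (here; there)
open import Data.List.Relation.Unary.All as All using (All; []; _∷_)
open import Data.List.Relation.Unary.All.Properties using (tabulate⁺; All¬⇒¬Any)
open import Data.List.Relation.Unary.AllPairs using ([]; _∷_)
open import Data.List.Relation.Unary.Unique.Propositional using (Unique)
open import Data.Product using (Σ; ∃-syntax; _×_; _,_; proj₁; proj₂)
open import Data.Sum using (_⊎_; inj₁; inj₂)
open import Function using (_∘_; id; case_of_)
open import Function.Bundles using (Equivalence; mk⇔)
open import Relation.Nullary using (¬_; Dec; does; yes; no; ¬?; contradiction)
open import Relation.Nullary.Decidable using (dec-true; dec-false; from-yes; _×-dec_)
open import Relation.Binary.PropositionalEquality
  using (_≡_; _≢_; refl; sym; trans; cong; subst; ≢-sym)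

module _ {a} {A : Set a} (p : A → Bool) where

  length-filterᵇ-none : ∀ {m} (f : Fin m → A) → (∀ j → ¬ T (p (f j))) →
                        length (filterᵇ p (tabulate f)) ≡ 0
  length-filterᵇ-none f none = cong length (filter-none (T? ∘ p) (tabulate⁺ none))

  length-filterᵇ-unique : ∀ {m} (f : Fin m → A) (w : Fin m) → T (p (f w)) →
                          (∀ j → T (p (f j)) → j ≡ w) → length (filterᵇ p (tabulate f)) ≡ 1
  length-filterᵇ-unique f zero pw unique
    rewrite filter-accept (T? ∘ p) {xs = tabulate (f ∘ suc)} pw =
    cong suc (length-filterᵇ-none (f ∘ suc) λ j pj → case unique (suc j) pj of λ ())
  length-filterᵇ-unique f (suc w) pw unique
    rewrite filter-reject (T? ∘ p) {xs = tabulate (f ∘ suc)} (λ p0 → case unique zero p0 of λ ()) =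
    length-filterᵇ-unique (f ∘ suc) w pw (λ j pj → suc-injective (unique (suc j) pj))

  length-filterᵇ-cong : ∀ {q : A → Bool} xs → (∀ x → p x ≡ q x) →
                        length (filterᵇ p xs) ≡ length (filterᵇ q xs)
  length-filterᵇ-cong {q} xs p≗q = cong length (filter-≐ (T? ∘ p) (T? ∘ q)
    ((λ {x} → subst T (p≗q x)) , (λ {x} → subst T (sym (p≗q x)))) xs)

∈-only-candidate : ∀ {a} {A : Set a} {y w : A} {L} →
                   y ∈ L → All (λ z → y ≢ z ⊎ z ≡ w) L → y ≡ w
∈-only-candidate y∈L candidates with All.lookup candidates y∈L
... | inj₁ y≢y = contradiction refl y≢y
... | inj₂ y≡w = y≡w

module _ {n} {x : Fin n} where

  ∈⇒notIn≡false : ∀ {R} → x ∈ R → notIn R x ≡ false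
  ∈⇒notIn≡false (here refl) rewrite dec-true (x ≟ x) refl = refl
  ∈⇒notIn≡false {y ∷ R} (there x∈R) with does (x ≟ y)
  ... | true  = refl
  ... | false = ∈⇒notIn≡false x∈R

  notIn⇒∉ : ∀ {R} → notIn R x ≡ true → x ∉ R
  notIn⇒∉ x∉R x∈R = case trans (sym x∉R) (∈⇒notIn≡false x∈R) of λ ()

  all≢⇒notIn : ∀ {R} → All (x ≢_) R → notIn R x ≡ true
  all≢⇒notIn []                    = refl
  all≢⇒notIn {y ∷ _} (x≢y ∷ x∉R) rewrite dec-false (x ≟ y) x≢y = all≢⇒notIn x∉R

  notIn⊎∈ : ∀ R → notIn R x ≡ true ⊎ x ∈ R
  notIn⊎∈ []      = inj₁ refl
  notIn⊎∈ (y ∷ R) with x ≟ y | notIn⊎∈ R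
  ... | yes x≡y | _        = inj₂ (here x≡y)
  ... | no _    | inj₁ x∉R = inj₁ x∉R
  ... | no _    | inj₂ x∈R = inj₂ (there x∈R)

injective⇒surjective : ∀ {n} {σ : Fin n → Fin n} → (∀ {i j} → σ i ≡ σ j → i ≡ j) →
                       ∀ v → ∃[ k ] σ k ≡ v
injective⇒surjective {suc m} {σ} σ-inj v with any? (λ k → σ k ≟ v)
... | yes hit = hit
... | no miss = contradiction (injective⇒≤ {f = τ} τ-inj) 1+n≰n
  where
  τ : Fin (suc m) → Fin m
  τ k = punchOut {i = v} {j = σ k} (λ v≡σk → miss (k , sym v≡σk))
  τ-inj : ∀ {i j} → τ i ≡ τ j → i ≡ j
  τ-inj = σ-inj ∘ punchOut-injective {i = v} _ _

-- Opaque, so that `recolour ps φ x` stays a neutral term: unfolded into nested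
-- `if`s, Agda could no longer infer `x` from equations about it.
opaque
  recolour : ∀ {n} → List (Fin n × Fin 4) → Coloring n → Coloring n
  recolour []             φ x = φ x
  recolour ((v , c) ∷ ps) φ x = if does (x ≟ v) then c else recolour ps φ x

  recolour-∉ : ∀ {n ps φ} {x : Fin n} → x ∉ map proj₁ ps → recolour ps φ x ≡ φ x
  recolour-∉ {ps = []}          _  = refl
  recolour-∉ {ps = (v , _) ∷ _} {x = x} x∉ rewrite dec-false (x ≟ v) (x∉ ∘ here) =
    recolour-∉ (x∉ ∘ there)

  recolour-∈ : ∀ {n ps φ c} {x : Fin n} → Unique (map proj₁ ps) → (x , c) ∈ ps →
               recolour ps φ x ≡ c
  recolour-∈ {x = x} _ (here refl) rewrite dec-true (x ≟ x) refl = refl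
  recolour-∈ {ps = (v , _) ∷ _} {x = x} (v∉ps ∷ unique) (there xc∈ps)
    rewrite dec-false (x ≟ v) (≢-sym (All.lookup v∉ps (∈-map⁺ proj₁ xc∈ps))) =
    recolour-∈ unique xc∈ps

fourth-colour : ∀ (a b c : Fin 4) → ∃[ d ] (d ≢ a × d ≢ b × d ≢ c)
fourth-colour = from-yes (all? λ a → all? λ b → all? λ c → any? (avoids? a b c))
  where
  avoids? : ∀ (a b c d : Fin 4) → Dec (d ≢ a × d ≢ b × d ≢ c)
  avoids? a b c d = ¬? (d ≟ a) ×-dec ¬? (d ≟ b) ×-dec ¬? (d ≟ c)

record Avoiding (a b c : Fin 4) : Set where
  field
    colour : Fin 4
    ≢₁     : colour ≢ a
    ≢₂     : colour ≢ b
    ≢₃     : colour ≢ c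

avoiding : ∀ a b c → Avoiding a b c
avoiding a b c = let d , d≢a , d≢b , d≢c = fourth-colour a b c in
  record { colour = d ; ≢₁ = d≢a ; ≢₂ = d≢b ; ≢₃ = d≢c }

NoIsolatedVertex : ∀ {n} → Graph n → Set
NoIsolatedVertex G = ∀ v → ∃[ x ] Adj G v x

ProperAt : ∀ {n} → Graph n → Coloring n → Fin n → Set
ProperAt G φ x = ∀ y → Adj G x y → φ x ≢ φ y

OddExtension : ∀ {n} → Graph n → List (Fin n) → Fin n → Coloring n → Set
OddExtension {n} G R v₁ φ′ =
  Σ (Coloring n) λ φ →
    (∀ x → notIn R x ≡ true → φ x ≡ φ′ x) ×
    ProperOn G allV φ ×
    (∀ v → v ≢ v₁ → OddCondition G allV φ v)

module OnGraph {n} (G : Graph n) where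

  adj-sym : ∀ {x y} → Adj G x y → Adj G y x
  adj-sym {x} {y} = trans (Graph.sym G y x)

  adj⇒≢ : ∀ {x y} → Adj G x y → x ≢ y
  adj⇒≢ {x} xy refl = case trans (sym xy) (irrefl G x) of λ ()

  adj⇒∈ : ∀ {x y L} → NbhdIs G x L → Adj G x y → y ∈ L
  adj⇒∈ N = Equivalence.to (N _)

  ∈⇒adj : ∀ {x y L} → NbhdIs G x L → y ∈ L → Adj G x y
  ∈⇒adj N = Equivalence.from (N _)

  nbhd-≢ : ∀ {x L} → NbhdIs G x L → All (x ≢_) L
  nbhd-≢ N = All.tabulate (adj⇒≢ ∘ ∈⇒adj N)

  ∉-nbhd : ∀ {x y L} → NbhdIs G x L → All (y ≢_) L → ¬ Adj G x y
  ∉-nbhd N y∉L = All¬⇒¬Any y∉L ∘ adj⇒∈ N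

  nbr-∉-nbhd⇒≢ : ∀ {x y z L} → NbhdIs G x L → All (z ≢_) L → Adj G y z → x ≢ y
  nbr-∉-nbhd⇒≢ N z∉L yz refl = ∉-nbhd N z∉L yz

  nbhd⊆ : ∀ {x L S} → NbhdIs G x L → All (_∈ S) L → ∀ {y} → Adj G x y → y ∈ S
  nbhd⊆ N L⊆S = All.lookup L⊆S ∘ adj⇒∈ N

  NbhdIs-resp : ∀ {x L L′} → NbhdIs G x L → All (_∈ L′) L → All (_∈ L) L′ → NbhdIs G x L′
  NbhdIs-resp N L⊆L′ L′⊆L _ = mk⇔ (nbhd⊆ N L⊆L′) (∈⇒adj N ∘ All.lookup L′⊆L)

  two-tree⇒noIsolatedVertex : IsTwoTree G → NoIsolatedVertex G
  two-tree⇒noIsolatedVertex (s≤s (s≤s (s≤s _)) , σ , σ-inj , triangle , attach) v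
    with injective⇒surjective σ-inj v
  ... | k , refl with toℕ k <? 3
  ...   | no k≮3 = let a , _ , a<k , _ , _ , nbrs = attach k (≮⇒≥ k≮3) in
                   σ a , Equivalence.from (nbrs a a<k) (inj₁ refl)
  ...   | yes k<3 = σ (other k) , triangle k (other k) k<3 (other<3 k) (other≢ k)
    where
    other : Fin _ → Fin _
    other zero    = suc zero
    other (suc _) = zero
    other<3 : ∀ k → toℕ (other k) < 3
    other<3 zero    = s≤s (s≤s z≤n)
    other<3 (suc _) = s≤s z≤n
    other≢ : ∀ k → k ≢ other k
    other≢ zero    ()
    other≢ (suc _) ()

  module _ {v₁ v₂ : Fin n} where

    conn-snoc : ∀ {u x y} → Conn G v₁ v₂ u x → Adj G x y → y ≢ v₁ → y ≢ v₂ → Conn G v₁ v₂ u y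
    conn-snoc (conn-refl x≢v₁ x≢v₂)      xy y≢v₁ y≢v₂ = conn-step x≢v₁ x≢v₂ xy (conn-refl y≢v₁ y≢v₂)
    conn-snoc (conn-step u≢v₁ u≢v₂ uz c) xy y≢v₁ y≢v₂ = conn-step u≢v₁ u≢v₂ uz (conn-snoc c xy y≢v₁ y≢v₂)

    conn-to-isolated⇒≡ : ∀ {u z} → Conn G v₁ v₂ u z → NbhdIs G z (v₁ ∷ v₂ ∷ []) → u ≡ z
    conn-to-isolated⇒≡ (conn-refl _ _) N = refl
    conn-to-isolated⇒≡ (conn-step u≢v₁ u≢v₂ uy c) N with conn-to-isolated⇒≡ c N
    ... | refl with adj⇒∈ N (adj-sym uy)
    ...   | here u≡v₁         = contradiction u≡v₁ u≢v₁
    ...   | there (here u≡v₂) = contradiction u≡v₂ u≢v₂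

    branch-conn : ∀ {u R x} → BranchWithVertices G v₁ v₂ u (v₁ ∷ v₂ ∷ R) →
                  x ∈ R → x ≢ v₁ → x ≢ v₂ → Conn G v₁ v₂ u x
    branch-conn (_ , _ , _ , branch) x∈R x≢v₁ x≢v₂
      with Equivalence.from (branch _) (there (there x∈R))
    ... | inj₁ x≡v₁        = contradiction x≡v₁ x≢v₁
    ... | inj₂ (inj₁ x≡v₂) = contradiction x≡v₂ x≢v₂
    ... | inj₂ (inj₂ u↝x)  = u↝x

    branch-closed : ∀ {u R x y} → BranchWithVertices G v₁ v₂ u (v₁ ∷ v₂ ∷ R) →
                    x ∈ R → x ≢ v₁ → x ≢ v₂ → Adj G x y → y ∈ v₁ ∷ v₂ ∷ R
    branch-closed {y = y} B@(_ , _ , _ , branch) x∈R x≢v₁ x≢v₂ xy with y ≟ v₁ | y ≟ v₂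
    ... | yes y≡v₁ | _        = here y≡v₁
    ... | no _     | yes y≡v₂ = there (here y≡v₂)
    ... | no y≢v₁  | no y≢v₂  = Equivalence.to (branch y)
      (inj₂ (inj₂ (conn-snoc (branch-conn B x∈R x≢v₁ x≢v₂) xy y≢v₁ y≢v₂)))

  module Coloured (φ : Coloring n) where

    ≢-by-colours : ∀ {x y c d} → φ x ≡ c → φ y ≡ d → c ≢ d → φ x ≢ φ y
    ≢-by-colours refl refl c≢d = c≢d

    proper-at : ∀ {x L} → NbhdIs G x L → All (λ y → φ x ≢ φ y) L → ProperAt G φ x
    proper-at N differ y xy = All.lookup differ (adj⇒∈ N xy)

    odd-at : ∀ {x L} w → NbhdIs G x L → w ∈ L → All (λ y → y ≡ w ⊎ φ y ≢ φ w) L →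
             OddCondition G allV φ x
    odd-at {x} w N w∈L unique = φ w , cong (_% 2) count≡1
      where
      sameColourNbr : Fin n → Bool
      sameColourNbr y = true ∧ adj G x y ∧ does (φ y ≟ φ w)
      w-counted : T (sameColourNbr w)
      w-counted rewrite ∈⇒adj N w∈L | dec-true (φ w ≟ φ w) refl = _
      only-w : ∀ y → T (sameColourNbr y) → y ≡ w
      only-w y _ with adj G x y in xy | φ y ≟ φ w
      ... | true | yes same = case All.lookup unique (adj⇒∈ N xy) of λ where
        (inj₁ y≡w)    → y≡w
        (inj₂ differ) → contradiction same differ
      count≡1 : colorNbrCount G allV φ x (φ w) ≡ 1
      count≡1 = length-filterᵇ-unique sameColourNbr id w w-counted only-w

    odd-at-degree-two : ∀ {x y z} → NbhdIs G x (y ∷ z ∷ []) → φ y ≢ φ z → OddCondition G allV φ x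
    odd-at-degree-two N differ = odd-at _ N (here refl) (inj₁ refl ∷ inj₂ (≢-sym differ) ∷ [])

  module _ {R : List (Fin n)} {φ′ φ : Coloring n}
           (agree : ∀ x → notIn R x ≡ true → φ x ≡ φ′ x) where

    count-preserved : ∀ v i → (∀ {x} → x ∈ R → Adj G v x → φ x ≢ i) →
                      colorNbrCount G allV φ v i ≡ colorNbrCount G (notIn R) φ′ v i
    count-preserved v i avoid = length-filterᵇ-cong _ (allFin n) sameIndicator
      where
      sameIndicator : ∀ x → (true ∧ adj G v x ∧ does (φ x ≟ i)) ≡
                            (notIn R x ∧ adj G v x ∧ does (φ′ x ≟ i))
      sameIndicator x with notIn⊎∈ {x = x} R
      ... | inj₁ x∉R rewrite x∉R | agree x x∉R = refl
      ... | inj₂ x∈R rewrite ∈⇒notIn≡false x∈R with adj G v x in vx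
      ...   | false = refl
      ...   | true  = dec-false (φ x ≟ i) (avoid x∈R vx)

    odd-preserved : ∀ {v i} → colorNbrCount G (notIn R) φ′ v i % 2 ≡ 1 →
                    (∀ {x} → x ∈ R → Adj G v x → φ x ≢ i) → OddCondition G allV φ v
    odd-preserved {v} {i} odd avoid = i , trans (cong (_% 2) (count-preserved v i avoid)) odd

    extend : ∀ {v₁ v₂} → NoIsolatedVertex G → OddColoringOn G (notIn R) φ′ →
             (∀ {x y} → x ∈ R → Adj G x y → y ∈ v₁ ∷ v₂ ∷ R) →
             (∀ {x} → x ∈ R → ProperAt G φ x) →
             (∀ {x} → x ∈ R → x ≢ v₁ → OddCondition G allV φ x) →
             OddCondition G allV φ v₂ →
             ProperOn G allV φ × (∀ v → v ≢ v₁ → OddCondition G allV φ v)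
    extend {v₁} {v₂} noIsolated (proper′ , odd′) closed proper odd odd-v₂ = properOn , oddOn
      where
      properOn : ProperOn G allV φ
      properOn x y _ _ xy with notIn⊎∈ {x = x} R | notIn⊎∈ {x = y} R
      ... | inj₂ x∈R | _        = proper x∈R y xy
      ... | inj₁ _   | inj₂ y∈R = ≢-sym (proper y∈R x (adj-sym xy))
      ... | inj₁ x∉R | inj₁ y∉R rewrite agree x x∉R | agree y y∉R = proper′ x y x∉R y∉R xy
      separated : ∀ {v x} → notIn R v ≡ true → v ≢ v₁ → v ≢ v₂ → x ∈ R → ¬ Adj G v x
      separated v∉R v≢v₁ v≢v₂ x∈R vx with closed x∈R (adj-sym vx)
      ... | here v≡v₁         = v≢v₁ v≡v₁
      ... | there (here v≡v₂) = v≢v₂ v≡v₂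
      ... | there (there v∈R) = notIn⇒∉ v∉R v∈R
      oddOn : ∀ v → v ≢ v₁ → OddCondition G allV φ v
      oddOn v v≢v₁ with notIn⊎∈ {x = v} R
      ... | inj₂ v∈R = odd v∈R v≢v₁
      ... | inj₁ v∉R with v ≟ v₂
      ...   | yes refl = odd-v₂
      ...   | no v≢v₂ with noIsolated v
      ...     | x , vx with notIn⊎∈ {x = x} R
      ...       | inj₂ x∈R = contradiction vx (separated v∉R v≢v₁ v≢v₂ x∈R)
      ...       | inj₁ x∉R =
        let _ , odd-i = odd′ v v∉R (x , x∉R , vx) in
        odd-preserved odd-i (λ y∈R vy → contradiction vy (separated v∉R v≢v₁ v≢v₂ y∈R))

  record BranchColouring (R : List (Fin n)) (φ′ : Coloring n) (v₂ : Fin n) (i : Fin 4) : Set where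
    field
      φ      : Coloring n
      agree  : ∀ x → notIn R x ≡ true → φ x ≡ φ′ x
      proper : All (ProperAt G φ) R
      odd    : All (OddCondition G allV φ) R
      avoid  : All (λ x → Adj G v₂ x → φ x ≢ i) R

  ear-colouring : ∀ {v₁ v₂ u₀ φ′} → NbhdIs G u₀ (v₁ ∷ v₂ ∷ []) → Unique (v₁ ∷ v₂ ∷ u₀ ∷ []) →
                  ∀ i → φ′ v₁ ≢ φ′ v₂ → BranchColouring (u₀ ∷ []) φ′ v₂ i
  ear-colouring {v₁} {v₂} {u₀} {φ′} N₀ ((_ ∷ v₁∉R) ∷ v₂∉R ∷ distinctR) i a≢b = record
    { φ      = φ
    ; agree  = λ _ → recolour-∉ ∘ notIn⇒∉
    ; proper = proper-at N₀ (≢-by-colours φu₀ φv₁ c₀≢a ∷ ≢-by-colours φu₀ φv₂ c₀≢b ∷ []) ∷ []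
    ; odd    = odd-at-degree-two N₀ (≢-by-colours φv₁ φv₂ a≢b) ∷ []
    ; avoid  = (λ _ → subst (_≢ i) (sym φu₀) c₀≢i) ∷ []
    }
    where
    open Avoiding (avoiding (φ′ v₁) (φ′ v₂) i)
      renaming (colour to c₀; ≢₁ to c₀≢a; ≢₂ to c₀≢b; ≢₃ to c₀≢i)
    φ : Coloring n
    φ = recolour ((u₀ , c₀) ∷ []) φ′
    open Coloured φ
    φv₁ : φ v₁ ≡ φ′ v₁
    φv₁ = recolour-∉ (All¬⇒¬Any v₁∉R)
    φv₂ : φ v₂ ≡ φ′ v₂
    φv₂ = recolour-∉ (All¬⇒¬Any v₂∉R)
    φu₀ : φ u₀ ≡ c₀
    φu₀ = recolour-∈ distinctR (here refl)

  hat-labels-distinct : ∀ {v₁ v₂ u₀ u₁ u₂} → IsHat G v₁ v₂ u₀ u₁ u₂ → u₁ ≢ v₂ →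
                        Unique (v₁ ∷ v₂ ∷ u₀ ∷ u₁ ∷ u₂ ∷ [])
  hat-labels-distinct {v₁} {v₂} {u₀} {u₁} {u₂} (B , N₀ , N₁ , N₂) u₁≢v₂
    with nbhd-≢ N₀ | nbhd-≢ N₁ | nbhd-≢ N₂
  ... | u₀≢v₁ ∷ u₀≢v₂ ∷ u₀≢u₁ ∷ u₀≢u₂ ∷ [] | u₁≢v₁ ∷ _ ∷ [] | u₂≢v₂ ∷ _ ∷ [] =
      (v₁≢v₂ ∷ ≢-sym u₀≢v₁ ∷ ≢-sym u₁≢v₁ ∷ v₁≢u₂ ∷ [])
    ∷ (≢-sym u₀≢v₂ ∷ ≢-sym u₁≢v₂ ∷ ≢-sym u₂≢v₂ ∷ [])
    ∷ (u₀≢u₁ ∷ u₀≢u₂ ∷ [])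
    ∷ (u₁≢u₂ ∷ [])
    ∷ [] ∷ []
    where
    v₁≢v₂ : v₁ ≢ v₂
    v₁≢v₂ = adj⇒≢ (proj₁ B)
    v₁≢u₂ : v₁ ≢ u₂
    v₁≢u₂ = ≢-sym (nbr-∉-nbhd⇒≢ N₂ (u₁≢v₂ ∷ ≢-sym u₀≢u₁ ∷ []) (adj-sym (∈⇒adj N₁ (here refl))))
    u₁≢u₂ : u₁ ≢ u₂
    u₁≢u₂ = nbr-∉-nbhd⇒≢ N₁ (≢-sym v₁≢v₂ ∷ ≢-sym u₀≢v₂ ∷ []) (∈⇒adj N₂ (here refl))

  hat-colouring : ∀ {v₁ v₂ u₀ u₁ u₂ φ′} → IsHat G v₁ v₂ u₀ u₁ u₂ →
                  Unique (v₁ ∷ v₂ ∷ u₀ ∷ u₁ ∷ u₂ ∷ []) →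
                  ∀ i → φ′ v₁ ≢ φ′ v₂ → BranchColouring (u₀ ∷ u₁ ∷ u₂ ∷ []) φ′ v₂ i
  hat-colouring {v₁} {v₂} {u₀} {u₁} {u₂} {φ′} (_ , N₀ , N₁ , N₂)
    ((v₁≢v₂ ∷ v₁∉R) ∷ v₂∉R@(v₂≢u₀ ∷ _) ∷ distinctR) i a≢b = record
    { φ      = φ
    ; agree  = λ _ → recolour-∉ ∘ notIn⇒∉
    ; proper = proper-at N₀ (≢-by-colours φu₀ φv₁ c₀≢a ∷ ≢-by-colours φu₀ φv₂ c₀≢b ∷
                             ≢-by-colours φu₀ φu₁ (≢-sym c₁≢c₀) ∷ ≢-by-colours φu₀ φu₂ (≢-sym c₂≢c₀) ∷ [])
             ∷ proper-at N₁ (≢-by-colours φu₁ φv₁ c₁≢a ∷ ≢-by-colours φu₁ φu₀ c₁≢c₀ ∷ [])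
             ∷ proper-at N₂ (≢-by-colours φu₂ φv₂ c₂≢b ∷ ≢-by-colours φu₂ φu₀ c₂≢c₀ ∷ []) ∷ []
    ; odd    = odd-at v₂ N₀ (there (here refl))
                 (inj₂ (≢-by-colours φv₁ φv₂ a≢b) ∷ inj₁ refl ∷
                  inj₂ (≢-by-colours φu₁ φv₂ c₁≢b) ∷ inj₂ (≢-by-colours φu₂ φv₂ c₂≢b) ∷ [])
             ∷ odd-at-degree-two N₁ (≢-by-colours φv₁ φu₀ (≢-sym c₀≢a))
             ∷ odd-at-degree-two N₂ (≢-by-colours φv₂ φu₀ (≢-sym c₀≢b)) ∷ []
    ; avoid  = (λ _ → subst (_≢ i) (sym φu₀) c₀≢i)
             ∷ (λ v₂∼u₁ → contradiction (adj-sym v₂∼u₁) (∉-nbhd N₁ (≢-sym v₁≢v₂ ∷ v₂≢u₀ ∷ [])))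
             ∷ (λ _ → subst (_≢ i) (sym φu₂) c₂≢i) ∷ []
    }
    where
    open Avoiding (avoiding (φ′ v₁) (φ′ v₂) i)
      renaming (colour to c₀; ≢₁ to c₀≢a; ≢₂ to c₀≢b; ≢₃ to c₀≢i)
    open Avoiding (avoiding (φ′ v₁) (φ′ v₂) c₀)
      renaming (colour to c₁; ≢₁ to c₁≢a; ≢₂ to c₁≢b; ≢₃ to c₁≢c₀)
    open Avoiding (avoiding (φ′ v₂) c₀ i)
      renaming (colour to c₂; ≢₁ to c₂≢b; ≢₂ to c₂≢c₀; ≢₃ to c₂≢i)
    φ : Coloring n
    φ = recolour ((u₀ , c₀) ∷ (u₁ , c₁) ∷ (u₂ , c₂) ∷ []) φ′
    open Coloured φ
    φv₁ : φ v₁ ≡ φ′ v₁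
    φv₁ = recolour-∉ (All¬⇒¬Any v₁∉R)
    φv₂ : φ v₂ ≡ φ′ v₂
    φv₂ = recolour-∉ (All¬⇒¬Any v₂∉R)
    φu₀ : φ u₀ ≡ c₀
    φu₀ = recolour-∈ distinctR (here refl)
    φu₁ : φ u₁ ≡ c₁
    φu₁ = recolour-∈ distinctR (there (here refl))
    φu₂ : φ u₂ ≡ c₂
    φu₂ = recolour-∈ distinctR (there (there (here refl)))

  hat-collapses : ∀ {v₁ v₂ u₀ u₂} → IsHat G v₁ v₂ u₀ v₂ u₂ → u₂ ≡ v₁
  hat-collapses (_ , N₀ , N₁ , N₂) with nbhd-≢ N₀
  ... | _ ∷ _ ∷ _ ∷ u₀≢u₂ ∷ [] = ∈-only-candidate (adj⇒∈ N₁ (adj-sym (∈⇒adj N₂ (here refl))))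
                                   (inj₂ refl ∷ inj₁ (≢-sym u₀≢u₂) ∷ [])

  double-hat-labels-distinct : ∀ {v₁ v₂ u₀ u₁ u₂ u₃ u₄ u₅ u₆} →
                               IsDoubleHat G v₁ v₂ u₀ u₁ u₂ u₃ u₄ u₅ u₆ → u₁ ≢ v₂ →
                               Unique (v₁ ∷ v₂ ∷ u₀ ∷ u₁ ∷ u₂ ∷ u₃ ∷ u₄ ∷ u₅ ∷ u₆ ∷ [])
  double-hat-labels-distinct {v₁} {v₂} {u₀} {u₁} {u₂} {u₃} {u₄} {u₅} {u₆}
    (B , N₀ , N₁ , N₂ , N₃ , N₄ , N₅ , N₆) u₁≢v₂
    with nbhd-≢ N₀ | nbhd-≢ N₁ | nbhd-≢ N₂ | nbhd-≢ N₃ | nbhd-≢ N₆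
  ... | u₀≢v₁ ∷ u₀≢v₂ ∷ u₀≢u₁ ∷ u₀≢u₂ ∷ u₀≢u₄ ∷ u₀≢u₅ ∷ [] | u₁≢v₁ ∷ _ ∷ u₁≢u₃ ∷ u₁≢u₄ ∷ []
      | u₂≢v₂ ∷ _ ∷ u₂≢u₅ ∷ u₂≢u₆ ∷ [] | u₃≢v₁ ∷ _ ∷ [] | u₆≢v₂ ∷ _ ∷ [] =
      (v₁≢v₂ ∷ ≢-sym u₀≢v₁ ∷ ≢-sym u₁≢v₁ ∷ v₁≢u₂ ∷ ≢-sym u₃≢v₁ ∷ v₁≢u₄ ∷ v₁≢u₅ ∷ v₁≢u₆ ∷ [])
    ∷ (≢-sym u₀≢v₂ ∷ ≢-sym u₁≢v₂ ∷ ≢-sym u₂≢v₂ ∷ v₂≢u₃ ∷ v₂≢u₄ ∷ v₂≢u₅ ∷ ≢-sym u₆≢v₂ ∷ [])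
    ∷ (u₀≢u₁ ∷ u₀≢u₂ ∷ u₀≢u₃ ∷ u₀≢u₄ ∷ u₀≢u₅ ∷ u₀≢u₆ ∷ [])
    ∷ (u₁≢u₂ ∷ u₁≢u₃ ∷ u₁≢u₄ ∷ u₁≢u₅ ∷ u₁≢u₆ ∷ [])
    ∷ (u₂≢u₃ ∷ u₂≢u₄ ∷ u₂≢u₅ ∷ u₂≢u₆ ∷ [])
    ∷ (u₃≢u₄ ∷ u₃≢u₅ ∷ u₃≢u₆ ∷ [])
    ∷ (u₄≢u₅ ∷ u₄≢u₆ ∷ [])
    ∷ (u₅≢u₆ ∷ [])
    ∷ [] ∷ []
    where
    v₁≢v₂ : v₁ ≢ v₂
    v₁≢v₂ = adj⇒≢ (proj₁ B)
    u₀∉N₃ : All (u₀ ≢_) (v₁ ∷ u₁ ∷ [])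
    u₀∉N₃ = u₀≢v₁ ∷ u₀≢u₁ ∷ []
    u₀∉N₆ : All (u₀ ≢_) (v₂ ∷ u₂ ∷ [])
    u₀∉N₆ = u₀≢v₂ ∷ u₀≢u₂ ∷ []
    v₂∉N₄ : All (v₂ ≢_) (u₀ ∷ u₁ ∷ [])
    v₂∉N₄ = ≢-sym u₀≢v₂ ∷ ≢-sym u₁≢v₂ ∷ []
    u₀≢u₃ : u₀ ≢ u₃
    u₀≢u₃ = ≢-sym (nbr-∉-nbhd⇒≢ N₃ (≢-sym v₁≢v₂ ∷ ≢-sym u₁≢v₂ ∷ []) (∈⇒adj N₀ (there (here refl))))
    u₂≢u₃ : u₂ ≢ u₃
    u₂≢u₃ = ≢-sym (nbr-∉-nbhd⇒≢ N₃ u₀∉N₃ (∈⇒adj N₂ (there (here refl))))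
    u₃≢u₄ : u₃ ≢ u₄
    u₃≢u₄ = nbr-∉-nbhd⇒≢ N₃ u₀∉N₃ (∈⇒adj N₄ (here refl))
    u₃≢u₅ : u₃ ≢ u₅
    u₃≢u₅ = nbr-∉-nbhd⇒≢ N₃ u₀∉N₃ (∈⇒adj N₅ (here refl))
    v₂≢u₃ : v₂ ≢ u₃
    v₂≢u₃ = ≢-sym (nbr-∉-nbhd⇒≢ N₃ u₀∉N₃ (adj-sym (∈⇒adj N₀ (there (here refl)))))
    v₂≢u₄ : v₂ ≢ u₄
    v₂≢u₄ = ≢-sym (nbr-∉-nbhd⇒≢ N₄ (≢-sym u₀≢v₁ ∷ ≢-sym u₁≢v₁ ∷ []) (adj-sym (proj₁ B)))
    u₂≢u₄ : u₂ ≢ u₄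
    u₂≢u₄ = ≢-sym (nbr-∉-nbhd⇒≢ N₄ v₂∉N₄ (∈⇒adj N₂ (here refl)))
    u₄≢u₆ : u₄ ≢ u₆
    u₄≢u₆ = nbr-∉-nbhd⇒≢ N₄ v₂∉N₄ (∈⇒adj N₆ (here refl))
    v₁≢u₄ : v₁ ≢ u₄
    v₁≢u₄ = ≢-sym (nbr-∉-nbhd⇒≢ N₄ (≢-sym u₀≢u₃ ∷ ≢-sym u₁≢u₃ ∷ []) (adj-sym (∈⇒adj N₃ (here refl))))
    u₁≢u₂ : u₁ ≢ u₂
    u₁≢u₂ = nbr-∉-nbhd⇒≢ N₁ (≢-sym v₁≢v₂ ∷ ≢-sym u₀≢v₂ ∷ v₂≢u₃ ∷ v₂≢u₄ ∷ []) (∈⇒adj N₂ (here refl))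
    u₄≢u₅ : u₄ ≢ u₅
    u₄≢u₅ = ≢-sym (nbr-∉-nbhd⇒≢ N₅ (≢-sym u₀≢u₁ ∷ u₁≢u₂ ∷ []) (∈⇒adj N₄ (there (here refl))))
    u₃∉N₅ : All (u₃ ≢_) (u₀ ∷ u₂ ∷ [])
    u₃∉N₅ = ≢-sym u₀≢u₃ ∷ ≢-sym u₂≢u₃ ∷ []
    v₁≢u₅ : v₁ ≢ u₅
    v₁≢u₅ = ≢-sym (nbr-∉-nbhd⇒≢ N₅ u₃∉N₅ (adj-sym (∈⇒adj N₃ (here refl))))
    u₁≢u₅ : u₁ ≢ u₅
    u₁≢u₅ = ≢-sym (nbr-∉-nbhd⇒≢ N₅ u₃∉N₅ (∈⇒adj N₁ (there (there (here refl)))))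
    u₁∉N₆ : All (u₁ ≢_) (v₂ ∷ u₂ ∷ [])
    u₁∉N₆ = u₁≢v₂ ∷ u₁≢u₂ ∷ []
    u₀≢u₆ : u₀ ≢ u₆
    u₀≢u₆ = ≢-sym (nbr-∉-nbhd⇒≢ N₆ u₁∉N₆ (∈⇒adj N₀ (there (there (here refl)))))
    u₁≢u₆ : u₁ ≢ u₆
    u₁≢u₆ = ≢-sym (nbr-∉-nbhd⇒≢ N₆ u₀∉N₆ (∈⇒adj N₁ (there (here refl))))
    u₃≢u₆ : u₃ ≢ u₆
    u₃≢u₆ = ≢-sym (nbr-∉-nbhd⇒≢ N₆ u₁∉N₆ (∈⇒adj N₃ (there (here refl))))
    u₅≢u₆ : u₅ ≢ u₆
    u₅≢u₆ = nbr-∉-nbhd⇒≢ N₅ (≢-sym u₀≢v₂ ∷ ≢-sym u₂≢v₂ ∷ []) (∈⇒adj N₆ (here refl))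
    v₁≢u₆ : v₁ ≢ u₆
    v₁≢u₆ = ≢-sym (nbr-∉-nbhd⇒≢ N₆ u₀∉N₆ (adj-sym (proj₁ (proj₂ B))))
    v₁≢u₂ : v₁ ≢ u₂
    v₁≢u₂ = ≢-sym (nbr-∉-nbhd⇒≢ N₂ (u₁≢v₂ ∷ ≢-sym u₀≢u₁ ∷ u₁≢u₅ ∷ u₁≢u₆ ∷ [])
                                   (adj-sym (∈⇒adj N₁ (here refl))))
    v₂≢u₅ : v₂ ≢ u₅
    v₂≢u₅ = ≢-sym (nbr-∉-nbhd⇒≢ N₅ (≢-sym u₀≢v₁ ∷ v₁≢u₂ ∷ []) (adj-sym (proj₁ B)))

  double-hat-colouring :
    ∀ {v₁ v₂ u₀ u₁ u₂ u₃ u₄ u₅ u₆ φ′} → IsDoubleHat G v₁ v₂ u₀ u₁ u₂ u₃ u₄ u₅ u₆ →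
    Unique (v₁ ∷ v₂ ∷ u₀ ∷ u₁ ∷ u₂ ∷ u₃ ∷ u₄ ∷ u₅ ∷ u₆ ∷ []) →
    ∀ i → φ′ v₁ ≢ φ′ v₂ → BranchColouring (u₀ ∷ u₁ ∷ u₂ ∷ u₃ ∷ u₄ ∷ u₅ ∷ u₆ ∷ []) φ′ v₂ i
  double-hat-colouring {v₁} {v₂} {u₀} {u₁} {u₂} {u₃} {u₄} {u₅} {u₆} {φ′}
    (_ , N₀ , N₁ , N₂ , N₃ , N₄ , N₅ , N₆)
    ((v₁≢v₂ ∷ v₁∉R) ∷ v₂∉R@(v₂≢u₀ ∷ v₂≢u₁ ∷ v₂≢u₂ ∷ v₂≢u₃ ∷ v₂≢u₄ ∷ _) ∷ distinctR) i a≢b = record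
    { φ      = φ
    ; agree  = λ _ → recolour-∉ ∘ notIn⇒∉
    ; proper = proper-at N₀ (≢-by-colours φu₀ φv₁ c₀≢a ∷ ≢-by-colours φu₀ φv₂ c₀≢b ∷
                             ≢-by-colours φu₀ φu₁ (≢-sym c₁≢c₀) ∷ ≢-by-colours φu₀ φu₂ (≢-sym c₂≢c₀) ∷
                             ≢-by-colours φu₀ φu₄ (≢-sym c₄≢c₀) ∷ ≢-by-colours φu₀ φu₅ (≢-sym c₅≢c₀) ∷ [])
             ∷ proper-at N₁ (≢-by-colours φu₁ φv₁ c₁≢a ∷ ≢-by-colours φu₁ φu₀ c₁≢c₀ ∷
                             ≢-by-colours φu₁ φu₃ (≢-sym c₃≢c₁) ∷ ≢-by-colours φu₁ φu₄ (≢-sym c₄≢c₁) ∷ [])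
             ∷ proper-at N₂ (≢-by-colours φu₂ φv₂ c₂≢b ∷ ≢-by-colours φu₂ φu₀ c₂≢c₀ ∷
                             ≢-by-colours φu₂ φu₅ (≢-sym c₅≢c₂) ∷ ≢-by-colours φu₂ φu₆ (≢-sym c₆≢c₂) ∷ [])
             ∷ proper-at N₃ (≢-by-colours φu₃ φv₁ c₃≢a ∷ ≢-by-colours φu₃ φu₁ c₃≢c₁ ∷ [])
             ∷ proper-at N₄ (≢-by-colours φu₄ φu₀ c₄≢c₀ ∷ ≢-by-colours φu₄ φu₁ c₄≢c₁ ∷ [])
             ∷ proper-at N₅ (≢-by-colours φu₅ φu₀ c₅≢c₀ ∷ ≢-by-colours φu₅ φu₂ c₅≢c₂ ∷ [])
             ∷ proper-at N₆ (≢-by-colours φu₆ φv₂ c₆≢b ∷ ≢-by-colours φu₆ φu₂ c₆≢c₂ ∷ []) ∷ []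
    ; odd    = odd-at v₂ N₀ (there (here refl))
                 (inj₂ (≢-by-colours φv₁ φv₂ a≢b) ∷ inj₁ refl ∷
                  inj₂ (≢-by-colours φu₁ φv₂ c₁≢b) ∷ inj₂ (≢-by-colours φu₂ φv₂ c₂≢b) ∷
                  inj₂ (≢-by-colours φu₄ φv₂ c₄≢b) ∷ inj₂ (≢-by-colours φu₅ φv₂ c₅≢b) ∷ [])
             ∷ odd-at u₀ N₁ (there (here refl))
                 (inj₂ (≢-by-colours φv₁ φu₀ (≢-sym c₀≢a)) ∷ inj₁ refl ∷
                  inj₂ (≢-by-colours φu₃ φu₀ c₃≢c₀) ∷ inj₂ (≢-by-colours φu₄ φu₀ c₄≢c₀) ∷ [])
             ∷ odd-at v₂ N₂ (here refl)
                 (inj₁ refl ∷ inj₂ (≢-by-colours φu₀ φv₂ c₀≢b) ∷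
                  inj₂ (≢-by-colours φu₅ φv₂ c₅≢b) ∷ inj₂ (≢-by-colours φu₆ φv₂ c₆≢b) ∷ [])
             ∷ odd-at-degree-two N₃ (≢-by-colours φv₁ φu₁ (≢-sym c₁≢a))
             ∷ odd-at-degree-two N₄ (≢-by-colours φu₀ φu₁ (≢-sym c₁≢c₀))
             ∷ odd-at-degree-two N₅ (≢-by-colours φu₀ φu₂ (≢-sym c₂≢c₀))
             ∷ odd-at-degree-two N₆ (≢-by-colours φv₂ φu₂ (≢-sym c₂≢b)) ∷ []
    ; avoid  = (λ _ → subst (_≢ i) (sym φu₀) c₀≢i)
             ∷ not-adjacent N₁ (≢-sym v₁≢v₂ ∷ v₂≢u₀ ∷ v₂≢u₃ ∷ v₂≢u₄ ∷ [])
             ∷ (λ _ → subst (_≢ i) (sym φu₂) c₂≢i)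
             ∷ not-adjacent N₃ (≢-sym v₁≢v₂ ∷ v₂≢u₁ ∷ [])
             ∷ not-adjacent N₄ (v₂≢u₀ ∷ v₂≢u₁ ∷ [])
             ∷ not-adjacent N₅ (v₂≢u₀ ∷ v₂≢u₂ ∷ [])
             ∷ (λ _ → subst (_≢ i) (sym φu₆) c₆≢i) ∷ []
    }
    where
    open Avoiding (avoiding (φ′ v₁) (φ′ v₂) i)
      renaming (colour to c₀; ≢₁ to c₀≢a; ≢₂ to c₀≢b; ≢₃ to c₀≢i)
    open Avoiding (avoiding (φ′ v₁) (φ′ v₂) c₀)
      renaming (colour to c₁; ≢₁ to c₁≢a; ≢₂ to c₁≢b; ≢₃ to c₁≢c₀)
    open Avoiding (avoiding (φ′ v₂) c₀ i)
      renaming (colour to c₂; ≢₁ to c₂≢b; ≢₂ to c₂≢c₀; ≢₃ to c₂≢i)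
    open Avoiding (avoiding (φ′ v₁) c₀ c₁)
      renaming (colour to c₃; ≢₁ to c₃≢a; ≢₂ to c₃≢c₀; ≢₃ to c₃≢c₁)
    open Avoiding (avoiding (φ′ v₂) c₀ c₁)
      renaming (colour to c₄; ≢₁ to c₄≢b; ≢₂ to c₄≢c₀; ≢₃ to c₄≢c₁)
    open Avoiding (avoiding (φ′ v₂) c₀ c₂)
      renaming (colour to c₅; ≢₁ to c₅≢b; ≢₂ to c₅≢c₀; ≢₃ to c₅≢c₂)
    open Avoiding (avoiding (φ′ v₂) c₂ i)
      renaming (colour to c₆; ≢₁ to c₆≢b; ≢₂ to c₆≢c₂; ≢₃ to c₆≢i)
    φ : Coloring n
    φ = recolour ((u₀ , c₀) ∷ (u₁ , c₁) ∷ (u₂ , c₂) ∷ (u₃ , c₃) ∷ (u₄ , c₄) ∷ (u₅ , c₅) ∷ (u₆ , c₆) ∷ [])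
                 φ′
    open Coloured φ
    not-adjacent : ∀ {x L} → NbhdIs G x L → All (v₂ ≢_) L → Adj G v₂ x → φ x ≢ i
    not-adjacent N v₂∉L v₂∼x = contradiction (adj-sym v₂∼x) (∉-nbhd N v₂∉L)
    φv₁ : φ v₁ ≡ φ′ v₁
    φv₁ = recolour-∉ (All¬⇒¬Any v₁∉R)
    φv₂ : φ v₂ ≡ φ′ v₂
    φv₂ = recolour-∉ (All¬⇒¬Any v₂∉R)
    φu₀ : φ u₀ ≡ c₀
    φu₀ = recolour-∈ distinctR (here refl)
    φu₁ : φ u₁ ≡ c₁
    φu₁ = recolour-∈ distinctR (there (here refl))
    φu₂ : φ u₂ ≡ c₂
    φu₂ = recolour-∈ distinctR (there (there (here refl)))
    φu₃ : φ u₃ ≡ c₃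
    φu₃ = recolour-∈ distinctR (there (there (there (here refl))))
    φu₄ : φ u₄ ≡ c₄
    φu₄ = recolour-∈ distinctR (there (there (there (there (here refl)))))
    φu₅ : φ u₅ ≡ c₅
    φu₅ = recolour-∈ distinctR (there (there (there (there (there (here refl))))))
    φu₆ : φ u₆ ≡ c₆
    φu₆ = recolour-∈ distinctR (there (there (there (there (there (there (here refl)))))))

  -- u₃ lies in the branch, so it is joined to u₀ in G - {v₁, v₂}, where it is
  -- isolated once u₁ = v₂; hence u₃ = u₀, so N(u₀) = {v₁, v₂}, forcing the rest.
  double-hat-collapses : ∀ {v₁ v₂ u₀ u₂ u₃ u₄ u₅ u₆} → IsDoubleHat G v₁ v₂ u₀ v₂ u₂ u₃ u₄ u₅ u₆ →
                         u₃ ≡ u₀ × u₂ ≡ v₁ × u₄ ≡ v₁ × u₅ ≡ v₂ × u₆ ≡ u₀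
  double-hat-collapses (B , N₀ , N₁ , N₂ , N₃ , N₄ , N₅ , N₆) with nbhd-≢ N₃
  ... | u₃≢v₁ ∷ u₃≢v₂ ∷ []
    with conn-to-isolated⇒≡ (branch-conn B (there (there (there (here refl)))) u₃≢v₁ u₃≢v₂) N₃
  ... | refl with nbhd-≢ N₂ | nbhd-≢ N₄
  ... | u₂≢v₂ ∷ _ | _ ∷ u₄≢v₂ ∷ []
    with ∈-only-candidate (adj⇒∈ N₃ (adj-sym (∈⇒adj N₂ (there (here refl))))) (inj₂ refl ∷ inj₁ u₂≢v₂ ∷ [])
       | ∈-only-candidate (adj⇒∈ N₃ (adj-sym (∈⇒adj N₄ (here refl)))) (inj₂ refl ∷ inj₁ u₄≢v₂ ∷ [])
  ... | refl | refl with nbhd-≢ N₅ | nbhd-≢ N₆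
  ... | _ ∷ u₅≢v₁ ∷ [] | _ ∷ u₆≢v₁ ∷ []
    with ∈-only-candidate (adj⇒∈ N₃ (adj-sym (∈⇒adj N₅ (here refl)))) (inj₁ u₅≢v₁ ∷ inj₂ refl ∷ [])
       | ∈-only-candidate (adj⇒∈ N₁ (adj-sym (∈⇒adj N₆ (here refl))))
                          (inj₁ u₆≢v₁ ∷ inj₂ refl ∷ inj₂ refl ∷ inj₁ u₆≢v₁ ∷ [])
  ... | refl | refl = refl , refl , refl , refl , refl

module Extensions {n} {G : Graph n} (noIsolated : NoIsolatedVertex G) where
  open OnGraph G

  triangle-extension : ∀ {v₁ v₂ u₀ R φ′} → OddColoringOn G (notIn R) φ′ →
                       NbhdIs G v₁ (v₂ ∷ u₀ ∷ []) → NbhdIs G v₂ (v₁ ∷ u₀ ∷ []) →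
                       NbhdIs G u₀ (v₁ ∷ v₂ ∷ []) →
                       All (_∈ v₁ ∷ v₂ ∷ u₀ ∷ []) R → All (_∈ R) (v₁ ∷ v₂ ∷ u₀ ∷ []) →
                       OddExtension G R v₁ φ′
  triangle-extension {v₁} {v₂} {u₀} {R} {φ′} odd′ N₁ N₂ N₀ R⊆T T⊆R@(v₁∈R ∷ v₂∈R ∷ u₀∈R ∷ [])
    with nbhd-≢ N₁ | nbhd-≢ N₂
  ... | v₁≢v₂ ∷ v₁≢u₀ ∷ [] | _ ∷ v₂≢u₀ ∷ [] =
    φ , agree , extend agree noIsolated odd′ closed (All.lookup proper ∘ inT) (All.lookup odd ∘ inT)
                  (odd-at-degree-two N₂ (≢-by-colours φv₁ φu₀ λ ()))
    where
    φ : Coloring n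
    φ = recolour ((v₁ , zero) ∷ (v₂ , suc zero) ∷ (u₀ , suc (suc zero)) ∷ []) φ′
    open Coloured φ
    inT : ∀ {x} → x ∈ R → x ∈ v₁ ∷ v₂ ∷ u₀ ∷ []
    inT = All.lookup R⊆T
    agree : ∀ x → notIn R x ≡ true → φ x ≡ φ′ x
    agree x x∉R = recolour-∉ (notIn⇒∉ x∉R ∘ All.lookup T⊆R)
    distinct : Unique (v₁ ∷ v₂ ∷ u₀ ∷ [])
    distinct = (v₁≢v₂ ∷ v₁≢u₀ ∷ []) ∷ (v₂≢u₀ ∷ []) ∷ [] ∷ []
    φv₁ : φ v₁ ≡ zero
    φv₁ = recolour-∈ distinct (here refl)
    φv₂ : φ v₂ ≡ suc zero
    φv₂ = recolour-∈ distinct (there (here refl))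
    φu₀ : φ u₀ ≡ suc (suc zero)
    φu₀ = recolour-∈ distinct (there (there (here refl)))
    nbrs∈R : All (λ x → ∀ {y} → Adj G x y → y ∈ R) (v₁ ∷ v₂ ∷ u₀ ∷ [])
    nbrs∈R = nbhd⊆ N₁ (v₂∈R ∷ u₀∈R ∷ [])
           ∷ nbhd⊆ N₂ (v₁∈R ∷ u₀∈R ∷ [])
           ∷ nbhd⊆ N₀ (v₁∈R ∷ v₂∈R ∷ []) ∷ []
    closed : ∀ {x y} → x ∈ R → Adj G x y → y ∈ v₁ ∷ v₂ ∷ R
    closed x∈R = there ∘ there ∘ All.lookup nbrs∈R (inT x∈R)
    proper : All (ProperAt G φ) (v₁ ∷ v₂ ∷ u₀ ∷ [])
    proper = proper-at N₁ (≢-by-colours φv₁ φv₂ (λ ()) ∷ ≢-by-colours φv₁ φu₀ (λ ()) ∷ [])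
           ∷ proper-at N₂ (≢-by-colours φv₂ φv₁ (λ ()) ∷ ≢-by-colours φv₂ φu₀ (λ ()) ∷ [])
           ∷ proper-at N₀ (≢-by-colours φu₀ φv₁ (λ ()) ∷ ≢-by-colours φu₀ φv₂ (λ ()) ∷ []) ∷ []
    odd : All (λ x → x ≢ v₁ → OddCondition G allV φ x) (v₁ ∷ v₂ ∷ u₀ ∷ [])
    odd = (λ v₁≢v₁ → contradiction refl v₁≢v₁)
        ∷ (λ _ → odd-at-degree-two N₂ (≢-by-colours φv₁ φu₀ (λ ())))
        ∷ (λ _ → odd-at-degree-two N₀ (≢-by-colours φv₁ φv₂ (λ ()))) ∷ []

  branch-extension : ∀ {v₁ v₂ u₀ R φ′} → BranchWithVertices G v₁ v₂ u₀ (v₁ ∷ v₂ ∷ R) →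
                     Unique (v₁ ∷ v₂ ∷ R) → OddColoringOn G (notIn R) φ′ →
                     (∀ i → φ′ v₁ ≢ φ′ v₂ → BranchColouring R φ′ v₂ i) → OddExtension G R v₁ φ′
  branch-extension {v₁} {v₂} {R = R} {φ′} B ((_ ∷ v₁∉R) ∷ v₂∉R ∷ _) odd′@(proper′ , oddCond′)
                   colouring =
    φ , agree , extend agree noIsolated odd′ closed (All.lookup proper) (λ x∈R _ → All.lookup odd x∈R)
                  (odd-preserved agree (proj₂ odd-v₂′) (All.lookup avoid))
    where
    odd-v₂′ : OddCondition G (notIn R) φ′ v₂
    odd-v₂′ = oddCond′ v₂ (all≢⇒notIn v₂∉R) (v₁ , all≢⇒notIn v₁∉R , adj-sym (proj₁ B))
    open BranchColouring (colouring (proj₁ odd-v₂′)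
                                    (proper′ v₁ v₂ (all≢⇒notIn v₁∉R) (all≢⇒notIn v₂∉R) (proj₁ B)))
    closed : ∀ {x y} → x ∈ R → Adj G x y → y ∈ v₁ ∷ v₂ ∷ R
    closed x∈R = branch-closed B x∈R (≢-sym (All.lookup v₁∉R x∈R)) (≢-sym (All.lookup v₂∉R x∈R))

  ear-extension : ∀ {v₁ v₂ u₀ φ′} → IsEar G v₁ v₂ u₀ → OddColoringOn G (notIn (u₀ ∷ [])) φ′ →
                  OddExtension G (u₀ ∷ []) v₁ φ′
  ear-extension {v₁} {v₂} {u₀} (B@(v₁∼v₂ , u₀∼v₁ , u₀∼v₂ , _) , N₀) odd′ =
    branch-extension B distinct odd′ (ear-colouring N₀ distinct)
    where
    distinct : Unique (v₁ ∷ v₂ ∷ u₀ ∷ [])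
    distinct = (adj⇒≢ v₁∼v₂ ∷ ≢-sym (adj⇒≢ u₀∼v₁) ∷ []) ∷ (≢-sym (adj⇒≢ u₀∼v₂) ∷ []) ∷ [] ∷ []

  collapsed-hat-extension : ∀ {v₁ v₂ u₀ φ′} → IsHat G v₁ v₂ u₀ v₂ v₁ →
                            OddColoringOn G (notIn (u₀ ∷ v₂ ∷ v₁ ∷ [])) φ′ →
                            OddExtension G (u₀ ∷ v₂ ∷ v₁ ∷ []) v₁ φ′
  collapsed-hat-extension (_ , N₀ , N₂ , N₁) odd′ =
    triangle-extension odd′ N₁ N₂
      (NbhdIs-resp N₀ (here refl ∷ there (here refl) ∷ there (here refl) ∷ here refl ∷ [])
                      (here refl ∷ there (here refl) ∷ []))
      (there (there (here refl)) ∷ there (here refl) ∷ here refl ∷ [])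
      (there (there (here refl)) ∷ there (here refl) ∷ here refl ∷ [])

  hat-extension : ∀ {v₁ v₂ u₀ u₁ u₂ φ′} → IsHat G v₁ v₂ u₀ u₁ u₂ →
                  OddColoringOn G (notIn (u₀ ∷ u₁ ∷ u₂ ∷ [])) φ′ →
                  OddExtension G (u₀ ∷ u₁ ∷ u₂ ∷ []) v₁ φ′
  hat-extension {v₂ = v₂} {u₁ = u₁} H@(B , _) odd′ with u₁ ≟ v₂
  ... | no u₁≢v₂ = branch-extension B (hat-labels-distinct H u₁≢v₂) odd′
                     (hat-colouring H (hat-labels-distinct H u₁≢v₂))
  ... | yes refl with hat-collapses H
  ...   | refl = collapsed-hat-extension H odd′

  collapsed-double-hat-extension :
    ∀ {v₁ v₂ u₀ φ′} → IsDoubleHat G v₁ v₂ u₀ v₂ v₁ u₀ v₁ v₂ u₀ →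
    OddColoringOn G (notIn (u₀ ∷ v₂ ∷ v₁ ∷ u₀ ∷ v₁ ∷ v₂ ∷ u₀ ∷ [])) φ′ →
    OddExtension G (u₀ ∷ v₂ ∷ v₁ ∷ u₀ ∷ v₁ ∷ v₂ ∷ u₀ ∷ []) v₁ φ′
  collapsed-double-hat-extension {v₁} {v₂} {u₀} (_ , _ , _ , _ , N₃ , N₄ , N₅ , _) odd′ =
    triangle-extension odd′
      (NbhdIs-resp N₄ (there (here refl) ∷ here refl ∷ []) (there (here refl) ∷ here refl ∷ []))
      (NbhdIs-resp N₅ (there (here refl) ∷ here refl ∷ []) (there (here refl) ∷ here refl ∷ []))
      N₃
      (u₀∈T ∷ v₂∈T ∷ v₁∈T ∷ u₀∈T ∷ v₁∈T ∷ v₂∈T ∷ u₀∈T ∷ [])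
      (there (there (here refl)) ∷ there (here refl) ∷ here refl ∷ [])
    where
    v₁∈T : v₁ ∈ v₁ ∷ v₂ ∷ u₀ ∷ []
    v₁∈T = here refl
    v₂∈T : v₂ ∈ v₁ ∷ v₂ ∷ u₀ ∷ []
    v₂∈T = there (here refl)
    u₀∈T : u₀ ∈ v₁ ∷ v₂ ∷ u₀ ∷ []
    u₀∈T = there (there (here refl))

  double-hat-extension : ∀ {v₁ v₂ u₀ u₁ u₂ u₃ u₄ u₅ u₆ φ′} →
                         IsDoubleHat G v₁ v₂ u₀ u₁ u₂ u₃ u₄ u₅ u₆ →
                         OddColoringOn G (notIn (u₀ ∷ u₁ ∷ u₂ ∷ u₃ ∷ u₄ ∷ u₅ ∷ u₆ ∷ [])) φ′ →
                         OddExtension G (u₀ ∷ u₁ ∷ u₂ ∷ u₃ ∷ u₄ ∷ u₅ ∷ u₆ ∷ []) v₁ φ′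
  double-hat-extension {v₂ = v₂} {u₁ = u₁} H@(B , _) odd′ with u₁ ≟ v₂
  ... | no u₁≢v₂ = branch-extension B (double-hat-labels-distinct H u₁≢v₂) odd′
                     (double-hat-colouring H (double-hat-labels-distinct H u₁≢v₂))
  ... | yes refl with double-hat-collapses H
  ...   | refl , refl , refl , refl , refl = collapsed-double-hat-extension H odd′

  special-branch-extension : ∀ {v₁ v₂ u₀ R φ′} → SpecialBranch G v₁ v₂ u₀ R →
                             OddColoringOn G (notIn R) φ′ → OddExtension G R v₁ φ′
  special-branch-extension (ear E)                   = ear-extension E
  special-branch-extension (hat _ _ H)               = hat-extension H
  special-branch-extension (doubleHat _ _ _ _ _ _ H) = double-hat-extension H

lemma3p2 : (n : ℕ) (G : Graph n) → IsTwoTree G →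
    (v₁ v₂ u₀ : Fin n) (R : List (Fin n)) → SpecialBranch G v₁ v₂ u₀ R →
    (φ′ : Coloring n) → OddColoringOn G (notIn R) φ′ →
    Σ (Coloring n) λ φ →
      (∀ x → notIn R x ≡ true → φ x ≡ φ′ x) ×
      ProperOn G allV φ ×
      (∀ v → v ≢ v₁ → OddCondition G allV φ v)
lemma3p2 n G twoTree v₁ v₂ u₀ R special φ′ = special-branch-extension special
  where open Extensions (OnGraph.two-tree⇒noIsolatedVertex G twoTree)
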